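{- Every bipartite monoid $(\mathcal{Q},\mathcal{P})$ has exactly one reduced quotient up to isomorphism: any two reduced bipartite monoids that are quotients of $(\mathcal{Q},\mathcal{P})$ are isomorphic (as bipartite monoids), and the reduction of $(\mathcal{Q},\mathcal{P})$ is such a reduced quotient.
   Context: A bipartite monoid is a pair $(\mathcal{Q},\mathcal{P})$ with $\mathcal{Q}$ a commutative monoid and $\mathcal{P}\subseteq\mathcal{Q}$. A bipartite monoid homomorphism $f:(\mathcal{Q},\mathcal{P})\to(\mathcal{S},\mathcal{R})$ is a monoid homomorphism with $x\in\mathcal{P}\iff f(x)\in\mathcal{R}$ for all $x$; isomorphisms are bijective homomorphisms. $(\mathcal{S},\mathcal{R})$ is a quotient of $(\mathcal{Q},\mathcal{P})$ if there is a surjective bipartite monoid homomorphism $(\mathcal{Q},\mathcal{P})\to(\mathcal{S},\mathcal{R})$. Elements $x,y$ are indistinguishable if $xz\in\mathcal{P}\iff yz\in\mathcal{P}$ for all $z\in\mathcal{Q}$; a bipartite monoid is reduced if its elements are pairwise distinguishable. The reduction of $(\mathcal{Q},\mathcal{P})$ is the bipartite monoid of indistinguishability classes, with the induced product and with distinguished subset the classes of elements of $\mathcal{P}$. -}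

module Defs where

open import Level using (Level; _⊔_)
open import Algebra.Bundles using (CommutativeMonoid)
open import Algebra.Structures using (IsCommutativeMonoid)
open import Data.Product using (Σ; _×_; _,_)
open import Function.Bundles using (_⇔_; mk⇔; Equivalence)
open import Relation.Binary.Structures using (IsEquivalence)

private
  variable
    c ℓ p c₁ ℓ₁ p₁ c₂ ℓ₂ p₂ : Level

record BipartiteMonoid (c ℓ p : Level) : Set (Level.suc (c ⊔ ℓ ⊔ p)) where
  field
    Q     : CommutativeMonoid c ℓ
  open CommutativeMonoid Q public
  field
    P     : Carrier → Set p
    P-resp : ∀ {x y} → x ≈ y → P x → P y

record IsBipartiteHom (A : BipartiteMonoid c₁ ℓ₁ p₁) (B : BipartiteMonoid c₂ ℓ₂ p₂)
         (f : BipartiteMonoid.Carrier A → BipartiteMonoid.Carrier B)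
         : Set (c₁ ⊔ ℓ₁ ⊔ p₁ ⊔ ℓ₂ ⊔ p₂) where
  private
    module A = BipartiteMonoid A
    module B = BipartiteMonoid B
  field
    cong     : ∀ {x y} → x A.≈ y → f x B.≈ f y
    homo-∙   : ∀ x y → f (x A.∙ y) B.≈ (f x B.∙ f y)
    homo-ε   : f A.ε B.≈ B.ε
    reflects : ∀ x → A.P x ⇔ B.P (f x)

Surjective : (A : BipartiteMonoid c₁ ℓ₁ p₁) (B : BipartiteMonoid c₂ ℓ₂ p₂) →
             (BipartiteMonoid.Carrier A → BipartiteMonoid.Carrier B) → Set (c₁ ⊔ c₂ ⊔ ℓ₂)
Surjective A B f = ∀ s → Σ (BipartiteMonoid.Carrier A) λ x → BipartiteMonoid._≈_ B (f x) s

Injective : (A : BipartiteMonoid c₁ ℓ₁ p₁) (B : BipartiteMonoid c₂ ℓ₂ p₂) →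
            (BipartiteMonoid.Carrier A → BipartiteMonoid.Carrier B) → Set (c₁ ⊔ ℓ₁ ⊔ ℓ₂)
Injective A B f = ∀ {x y} → BipartiteMonoid._≈_ B (f x) (f y) → BipartiteMonoid._≈_ A x y

IsQuotientOf : BipartiteMonoid c₂ ℓ₂ p₂ → BipartiteMonoid c₁ ℓ₁ p₁ → Set _
IsQuotientOf S A = Σ (BipartiteMonoid.Carrier A → BipartiteMonoid.Carrier S) λ f →
  IsBipartiteHom A S f × Surjective A S f

Isomorphic : BipartiteMonoid c₁ ℓ₁ p₁ → BipartiteMonoid c₂ ℓ₂ p₂ → Set _
Isomorphic A B = Σ (BipartiteMonoid.Carrier A → BipartiteMonoid.Carrier B) λ f →
  IsBipartiteHom A B f × (Injective A B f × Surjective A B f)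

Indistinguishable : (A : BipartiteMonoid c ℓ p) →
  BipartiteMonoid.Carrier A → BipartiteMonoid.Carrier A → Set (c ⊔ p)
Indistinguishable A x y = ∀ z → P (x ∙ z) ⇔ P (y ∙ z)
  where open BipartiteMonoid A

Reduced : BipartiteMonoid c ℓ p → Set (c ⊔ ℓ ⊔ p)
Reduced A = ∀ x y → Indistinguishable A x y → BipartiteMonoid._≈_ A x y

-- The reduction: the quotient by indistinguishability, realised as a
-- setoid quotient (same carrier, equality := indistinguishability),
-- with induced product and distinguished subset the classes of P.
module Reduction (A : BipartiteMonoid c ℓ p) where
  open BipartiteMonoid A
  private
    _~_ = Indistinguishable A
    infix 4 _~_

    to : ∀ {a b} {X : Set a} {Y : Set b} → X ⇔ Y → X → Y
    to = Equivalence.to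
    from : ∀ {a b} {X : Set a} {Y : Set b} → X ⇔ Y → Y → X
    from = Equivalence.from

    ⇔-trans : ∀ {a b d} {X : Set a} {Y : Set b} {Z : Set d} → X ⇔ Y → Y ⇔ Z → X ⇔ Z
    ⇔-trans e f = mk⇔ (λ x → to f (to e x)) (λ z → from e (from f z))

    P≈ : ∀ {x y} → x ≈ y → P x ⇔ P y
    P≈ e = mk⇔ (P-resp e) (P-resp (sym e))

    ≈⇒~ : ∀ {x y} → x ≈ y → x ~ y
    ≈⇒~ e z = P≈ (∙-cong e refl)

    ~-equiv : IsEquivalence _~_
    ~-equiv = record
      { refl  = λ z → mk⇔ (λ q → q) (λ q → q)
      ; sym   = λ e z → mk⇔ (from (e z)) (to (e z))
      ; trans = λ e f z → ⇔-trans (e z) (f z)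
      }

    ~-∙-cong : ∀ {x y u v} → x ~ y → u ~ v → (x ∙ u) ~ (y ∙ v)
    ~-∙-cong {x} {y} {u} {v} e f z =
      ⇔-trans (P≈ (assoc x u z)) (
      ⇔-trans (e (u ∙ z)) (
      ⇔-trans (P≈ (trans (sym (assoc y u z)) (trans (∙-cong (comm y u) refl) (assoc u y z)))) (
      ⇔-trans (f (y ∙ z)) (
      P≈ (trans (sym (assoc v y z)) (∙-cong (comm v y) refl))))))

    isCM : IsCommutativeMonoid _~_ _∙_ ε
    isCM = record
      { isMonoid = record
        { isSemigroup = record
          { isMagma = record { isEquivalence = ~-equiv ; ∙-cong = ~-∙-cong }
          ; assoc = λ x y z → ≈⇒~ (assoc x y z)
          }
        ; identity = (λ x → ≈⇒~ (identityˡ x)) , (λ x → ≈⇒~ (identityʳ x))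
        }
      ; comm = λ x y → ≈⇒~ (comm x y)
      }

    P-resp~ : ∀ {x y} → x ~ y → P x → P y
    P-resp~ {x} {y} e q = P-resp (identityʳ y) (to (e ε) (P-resp (sym (identityʳ x)) q))

  reduction : BipartiteMonoid c (c ⊔ p) p
  reduction = record
    { Q = record { isCommutativeMonoid = isCM }
    ; P = P
    ; P-resp = P-resp~
    }

open Reduction public using (reduction)

{-# OPTIONS --safe #-}
-- A surjective homomorphism f onto a reduced bipartite monoid identifies
-- exactly the indistinguishable elements: f x ≈ f y makes x z and y z agree
-- on P because f is multiplicative and reflects P, and conversely, since
-- every element of the target is some f z, indistinguishable x and y have
-- indistinguishable images, which are equal by reducedness.  Two reduced
-- quotients of (Q , P) therefore have the same kernel, and the map
-- f x ↦ g x is a well-defined isomorphism between them.  The reduction is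
-- reduced since it has the product and distinguished subset of (Q , P),
-- hence the same indistinguishability relation, which is its equality.
module Submission where

open import Defs
open import Level using (Level)
open import Data.Product using (_×_; _,_; proj₁; proj₂)
open import Function.Base using (_∘_; id)
open import Function.Bundles using (_⇔_; mk⇔)
open import Function.Construct.Identity using (⇔-id)
open import Function.Construct.Symmetry using (⇔-sym)
open import Function.Related.Propositional using (module EquationalReasoning)

private
  variable
    c ℓ p c₁ ℓ₁ p₁ c₂ ℓ₂ p₂ : Level

module _ (A : BipartiteMonoid c ℓ p) where
  open BipartiteMonoid A

  P-cong : ∀ {x y} → x ≈ y → P x ⇔ P y
  P-cong x≈y = mk⇔ (P-resp x≈y) (P-resp (sym x≈y))

module _ {A : BipartiteMonoid c ℓ p} {S : BipartiteMonoid c₁ ℓ₁ p₁}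
         {f : BipartiteMonoid.Carrier A → BipartiteMonoid.Carrier S}
         (f-hom : IsBipartiteHom A S f) where
  private
    module A = BipartiteMonoid A
    module S = BipartiteMonoid S
    open IsBipartiteHom f-hom
  open EquationalReasoning

  reflects-∙ : ∀ x z → A.P (x A.∙ z) ⇔ S.P (f x S.∙ f z)
  reflects-∙ x z = begin
    A.P (x A.∙ z)       ∼⟨ reflects (x A.∙ z) ⟩
    S.P (f (x A.∙ z))   ∼⟨ P-cong S (homo-∙ x z) ⟩
    S.P (f x S.∙ f z)   ∎

  homo-≈⇒indistinguishable : ∀ {x y} → f x S.≈ f y → Indistinguishable A x y
  homo-≈⇒indistinguishable {x} {y} fx≈fy z = begin
    A.P (x A.∙ z)       ∼⟨ reflects-∙ x z ⟩
    S.P (f x S.∙ f z)   ∼⟨ P-cong S (S.∙-cong fx≈fy S.refl) ⟩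
    S.P (f y S.∙ f z)   ∼⟨ ⇔-sym (reflects-∙ y z) ⟩
    A.P (y A.∙ z)       ∎

  module _ (f-surj : Surjective A S f) where

    indistinguishable⇒homo-indistinguishable : ∀ {x y} →
      Indistinguishable A x y → Indistinguishable S (f x) (f y)
    indistinguishable⇒homo-indistinguishable {x} {y} x~y s = begin
      S.P (f x S.∙ s)     ∼⟨ P-cong S (S.∙-cong S.refl (S.sym fz≈s)) ⟩
      S.P (f x S.∙ f z)   ∼⟨ ⇔-sym (reflects-∙ x z) ⟩
      A.P (x A.∙ z)       ∼⟨ x~y z ⟩
      A.P (y A.∙ z)       ∼⟨ reflects-∙ y z ⟩
      S.P (f y S.∙ f z)   ∼⟨ P-cong S (S.∙-cong S.refl fz≈s) ⟩
      S.P (f y S.∙ s)     ∎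
      where
        z = proj₁ (f-surj s)
        fz≈s = proj₂ (f-surj s)

    indistinguishable⇒homo-≈ : Reduced S →
      ∀ {x y} → Indistinguishable A x y → f x S.≈ f y
    indistinguishable⇒homo-≈ S-reduced {x} {y} =
      S-reduced (f x) (f y) ∘ indistinguishable⇒homo-indistinguishable

module Factorisation
  {A : BipartiteMonoid c ℓ p} {S : BipartiteMonoid c₁ ℓ₁ p₁} {T : BipartiteMonoid c₂ ℓ₂ p₂}
  {f : BipartiteMonoid.Carrier A → BipartiteMonoid.Carrier S}
  {g : BipartiteMonoid.Carrier A → BipartiteMonoid.Carrier T}
  (f-hom : IsBipartiteHom A S f) (f-surj : Surjective A S f) (g-hom : IsBipartiteHom A T g)
  (ker-f⊆ker-g : ∀ {x y} → BipartiteMonoid._≈_ S (f x) (f y) → BipartiteMonoid._≈_ T (g x) (g y))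
  where
  private
    module A = BipartiteMonoid A
    module S = BipartiteMonoid S
    module T = BipartiteMonoid T
    module F = IsBipartiteHom f-hom
    module G = IsBipartiteHom g-hom

    section : S.Carrier → A.Carrier
    section s = proj₁ (f-surj s)

    f∘section : ∀ s → f (section s) S.≈ s
    f∘section s = proj₂ (f-surj s)

  induced : S.Carrier → T.Carrier
  induced = g ∘ section

  induced-≈ : ∀ {x s} → f x S.≈ s → induced s T.≈ g x
  induced-≈ {x} {s} fx≈s = ker-f⊆ker-g (S.trans (f∘section s) (S.sym fx≈s))

  induced-isBipartiteHom : IsBipartiteHom S T induced
  induced-isBipartiteHom = record
    { cong     = λ {s} s≈s′ → T.sym (induced-≈ (S.trans (f∘section s) s≈s′))
    ; homo-∙   = λ s s′ → T.trans
        (induced-≈ (S.trans (F.homo-∙ (section s) (section s′))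
                            (S.∙-cong (f∘section s) (f∘section s′))))
        (G.homo-∙ (section s) (section s′))
    ; homo-ε   = T.trans (induced-≈ F.homo-ε) G.homo-ε
    ; reflects = induced-reflects
    }
    where
      open EquationalReasoning
      induced-reflects : ∀ s → S.P s ⇔ T.P (induced s)
      induced-reflects s = begin
        S.P s                   ∼⟨ P-cong S (S.sym (f∘section s)) ⟩
        S.P (f (section s))     ∼⟨ ⇔-sym (F.reflects (section s)) ⟩
        A.P (section s)         ∼⟨ G.reflects (section s) ⟩
        T.P (g (section s))     ∎

  induced-injective : (∀ {x y} → g x T.≈ g y → f x S.≈ f y) → Injective S T induced
  induced-injective ker-g⊆ker-f {s} {s′} hs≈hs′ =
    S.trans (S.sym (f∘section s)) (S.trans (ker-g⊆ker-f hs≈hs′) (f∘section s′))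

  induced-surjective : Surjective A T g → Surjective S T induced
  induced-surjective g-surj t = f x , T.trans (induced-≈ S.refl) gx≈t
    where
      x = proj₁ (g-surj t)
      gx≈t = proj₂ (g-surj t)

reduced-quotients-isomorphic : (A : BipartiteMonoid c ℓ p)
  (S : BipartiteMonoid c₁ ℓ₁ p₁) (T : BipartiteMonoid c₂ ℓ₂ p₂) →
  Reduced S → Reduced T → IsQuotientOf S A → IsQuotientOf T A → Isomorphic S T
reduced-quotients-isomorphic A S T S-reduced T-reduced (f , f-hom , f-surj) (g , g-hom , g-surj) =
  induced , induced-isBipartiteHom , induced-injective ker-g⊆ker-f , induced-surjective g-surj
  where
    module S = BipartiteMonoid S
    module T = BipartiteMonoid T

    ker-f⊆ker-g : ∀ {x y} → f x S.≈ f y → g x T.≈ g y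
    ker-f⊆ker-g = indistinguishable⇒homo-≈ g-hom g-surj T-reduced ∘ homo-≈⇒indistinguishable f-hom

    ker-g⊆ker-f : ∀ {x y} → g x T.≈ g y → f x S.≈ f y
    ker-g⊆ker-f = indistinguishable⇒homo-≈ f-hom f-surj S-reduced ∘ homo-≈⇒indistinguishable g-hom

    open Factorisation f-hom f-surj g-hom ker-f⊆ker-g

module _ (A : BipartiteMonoid c ℓ p) where
  private
    module A = BipartiteMonoid A
    module R = BipartiteMonoid (reduction A)

  reduction-reduced : Reduced (reduction A)
  reduction-reduced x y x~y = x~y

  id-isBipartiteHom : IsBipartiteHom A (reduction A) id
  id-isBipartiteHom = record
    { cong     = λ x≈y z → P-cong A (A.∙-cong x≈y A.refl)
    ; homo-∙   = λ x y → R.refl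
    ; homo-ε   = R.refl
    ; reflects = λ x → ⇔-id _
    }

  reduction-isQuotient : IsQuotientOf (reduction A) A
  reduction-isQuotient = id , id-isBipartiteHom , λ s → s , R.refl

mainTheorem10 : ∀ {c ℓ p c₁ ℓ₁ p₁ c₂ ℓ₂ p₂ : Level} (A : BipartiteMonoid c ℓ p) →
    (∀ (S : BipartiteMonoid c₁ ℓ₁ p₁) (T : BipartiteMonoid c₂ ℓ₂ p₂) →
       Reduced S → Reduced T → IsQuotientOf S A → IsQuotientOf T A →
       Isomorphic S T)
    × (Reduced (reduction A) × IsQuotientOf (reduction A) A)
mainTheorem10 A = reduced-quotients-isomorphic A , reduction-reduced A , reduction-isQuotient A
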